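{- Let $\mathscr{A}$ be an implicative structure. For each separator $S\subseteq\mathscr{A}$, the following are equivalent: (1) $S$ is an ultraseparator of $\mathscr{A}$. (2) The induced Heyting algebra $(\mathscr{A}/S,\le_S)$ is the 2-element Boolean algebra.
   Context: An implicative structure is a complete lattice $(\mathscr{A},\preccurlyeq)$ (meets $\bigwedge$, bottom $\bot$) with $\to$ anti-monotonic in its first and monotonic in its second argument, commuting with arbitrary meets in its second argument. A separator is an upwards closed subset containing $\bigwedge_{a,b}(a\to b\to a)$ and $\bigwedge_{a,b,c}((a\to b\to c)\to(a\to b)\to a\to c)$ and closed under modus ponens; it is consistent if $\bot\notin S$. An ultraseparator is a consistent separator that is maximal (w.r.t. inclusion) among consistent separators. $(\mathscr{A}/S,\le_S)$ is the Heyting algebra obtained as the poset reflection of the preorder $a\vdash_S b$ iff $(a\to b)\in S$. -}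

module Defs where

open import Level using (Level; suc)
open import Data.Product using (Σ; ∃; _×_; _,_)
open import Data.Bool using (Bool; true; false)
import Data.Bool as B
open import Relation.Binary.PropositionalEquality using (_≡_)
open import Relation.Nullary using (¬_)
open import Function.Bundles using (_⇔_)

Pred : ∀ {ℓ} → Set ℓ → Set (suc ℓ)
Pred {ℓ} A = A → Set ℓ

record ImplicativeStructure (ℓ : Level) : Set (suc ℓ) where
  infixr 5 _⇒_
  infix 4 _≼_
  field
    Carrier  : Set ℓ
    _≼_      : Carrier → Carrier → Set ℓ
    ≼-refl   : ∀ {a} → a ≼ a
    ≼-trans  : ∀ {a b c} → a ≼ b → b ≼ c → a ≼ c
    ≼-antisym : ∀ {a b} → a ≼ b → b ≼ a → a ≡ b
    ⋀        : Pred Carrier → Carrier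
    ⋀-lower  : ∀ (X : Pred Carrier) {x} → X x → ⋀ X ≼ x
    ⋀-greatest : ∀ (X : Pred Carrier) {y} → (∀ {x} → X x → y ≼ x) → y ≼ ⋀ X
    ⊥        : Carrier
    ⊥-least  : ∀ {a} → ⊥ ≼ a
    _⇒_      : Carrier → Carrier → Carrier
    ⇒-mono   : ∀ {a a' b b'} → a' ≼ a → b ≼ b' → (a ⇒ b) ≼ (a' ⇒ b')
    ⇒-⋀      : ∀ (a : Carrier) (B : Pred Carrier) →
               (a ⇒ ⋀ B) ≡ ⋀ (λ x → Σ Carrier λ b → B b × (x ≡ (a ⇒ b)))

  𝐊 : Carrier
  𝐊 = ⋀ (λ x → Σ Carrier λ a → Σ Carrier λ b → x ≡ (a ⇒ b ⇒ a))

  𝐒 : Carrier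
  𝐒 = ⋀ (λ x → Σ Carrier λ a → Σ Carrier λ b → Σ Carrier λ c →
               x ≡ ((a ⇒ b ⇒ c) ⇒ (a ⇒ b) ⇒ a ⇒ c))

  record IsSeparator (S : Pred Carrier) : Set ℓ where
    field
      upward : ∀ {a b} → S a → a ≼ b → S b
      K∈S    : S 𝐊
      S∈S    : S 𝐒
      mp     : ∀ {a b} → S (a ⇒ b) → S a → S b

  Consistent : Pred Carrier → Set ℓ
  Consistent S = ¬ S ⊥

  _⊆_ : Pred Carrier → Pred Carrier → Set ℓ
  S ⊆ T = ∀ {a} → S a → T a

  record IsUltraseparator (S : Pred Carrier) : Set (suc ℓ) where
    field
      separator  : IsSeparator S
      consistent : Consistent S
      maximal    : ∀ (T : Pred Carrier) → IsSeparator T → Consistent T →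
                   S ⊆ T → T ⊆ S

  _⊢[_]_ : Carrier → Pred Carrier → Carrier → Set ℓ
  a ⊢[ S ] b = S (a ⇒ b)

  -- The poset reflection A/S of (A, ⊢_S) is order-isomorphic to the
  -- 2-element Boolean algebra {false < true}: there is a surjection
  -- f : A → Bool with  a ⊢_S b ⇔ f a ≤ f b.  Such an f induces exactly an
  -- order isomorphism A/S ≅ 2 (it is constant on ⊢_S-classes, reflects and
  -- preserves the order, and is onto), and conversely any such isomorphism
  -- composed with the projection A → A/S is such an f.
  QuotientIsTwoElementBA : Pred Carrier → Set ℓ
  QuotientIsTwoElementBA S =
    Σ (Carrier → Bool) λ f →
      (∀ (β : Bool) → ∃ λ a → f a ≡ β) ×
      (∀ a b → (a ⊢[ S ] b) ⇔ (f a B.≤ f b))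

module Submission where

-- Both conditions are compared with an intermediate one: S is consistent and
-- COMPLETE, i.e. every a ∉ S is refuted by S (a ⊢_S ⊥).
--  * Elementary separator facts (identity, weakening, ex falso) are derived
--    from K and S, and the "relative" separator S[a] = {x | a ⊢_S x} is shown
--    to be a separator containing S and a.
--  * Ultra ⇒ complete: if a ∉ S and a ⊬_S ⊥, then S[a] is a consistent
--    separator extending S, hence equal to S by maximality, so a ∈ S.
--  * Consistent + complete ⇒ ultra: a consistent R ⊇ S containing some t ∉ S
--    would contain t → ⊥ and hence ⊥.
--  * For a consistent complete S, a ⊢_S b iff (a ∈ S → b ∈ S); so the
--    characteristic function of S (decided by excluded middle) is an order
--    isomorphism onto 2. Conversely such a map f has f a = true iff a ∈ S,
--    from which consistency and completeness follow.

open import Defs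
open import Axiom.ExcludedMiddle using (ExcludedMiddle)
open import Function.Bundles using (_⇔_; mk⇔; Equivalence)
import Function.Properties.Equivalence as ⇔
open import Function.Related.TypeIsomorphisms using (→-cong-⇔)
open import Data.Product using (∃; _×_; _,_)
open import Data.Bool using (Bool; true; false; T)
import Data.Bool as B
open import Data.Bool.Properties using (T-≡; ≤-minimum)
open import Data.Unit using (tt)
open import Data.Empty using (⊥-elim)
open import Relation.Binary.PropositionalEquality using (_≡_; refl; subst)
open import Relation.Nullary using (¬_; yes; no)
open import Relation.Nullary.Decidable using (isYes; toWitness; fromWitness)

≤⇔T-implication : ∀ {x y : Bool} → x B.≤ y ⇔ (T x → T y)
≤⇔T-implication {false} {y}     = mk⇔ (λ _ ()) (λ _ → ≤-minimum y)
≤⇔T-implication {true}  {false} = mk⇔ (λ ()) (λ h → ⊥-elim (h tt))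
≤⇔T-implication {true}  {true}  = mk⇔ (λ _ t → t) (λ _ → B.b≤b)

module SeparatorTheory {ℓ} (𝒜 : ImplicativeStructure ℓ) where
  open ImplicativeStructure 𝒜
  open Equivalence using (to; from)

  Complete : Pred Carrier → Set ℓ
  Complete S = ∀ a → ¬ S a → a ⊢[ S ] ⊥

  Relative : Pred Carrier → Carrier → Pred Carrier
  Relative S a x = a ⊢[ S ] x

  module _ {S : Pred Carrier} (sep : IsSeparator S) where
    open IsSeparator sep

    K-instance : ∀ a b → S (a ⇒ b ⇒ a)
    K-instance a b = upward K∈S (⋀-lower _ (a , b , refl))

    S-instance : ∀ a b c → S ((a ⇒ b ⇒ c) ⇒ (a ⇒ b) ⇒ a ⇒ c)
    S-instance a b c = upward S∈S (⋀-lower _ (a , b , c , refl))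

    -- I = S K K: every element entails itself.
    ⊢-refl : ∀ a → a ⊢[ S ] a
    ⊢-refl a = mp (mp (S-instance a (a ⇒ a) a) (K-instance a (a ⇒ a))) (K-instance a a)

    weaken : ∀ a {b} → S b → a ⊢[ S ] b
    weaken a {b} sb = mp (K-instance b a) sb

    ⊢-≼ : ∀ {a b c} → a ⊢[ S ] b → b ≼ c → a ⊢[ S ] c
    ⊢-≼ a⊢b b≼c = upward a⊢b (⇒-mono ≼-refl b≼c)

    ex-falso : ∀ a → ⊥ ⊢[ S ] a
    ex-falso a = ⊢-≼ (⊢-refl ⊥) ⊥-least

    -- S[a] is a separator (modus ponens in it is the S combinator).
    relative-separator : ∀ a → IsSeparator (Relative S a)
    relative-separator a = record
      { upward = ⊢-≼
      ; K∈S    = weaken a K∈S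
      ; S∈S    = weaken a S∈S
      ; mp     = λ {x} {y} a⊢x⇒y a⊢x → mp (mp (S-instance a x y) a⊢x⇒y) a⊢x
      }

    -- An ultraseparator refutes what it does not contain: otherwise S[a]
    -- would be a consistent extension of S containing a.
    ultra⇒complete : ExcludedMiddle ℓ → IsUltraseparator S → Complete S
    ultra⇒complete em ultra a a∉S with em {a ⊢[ S ] ⊥}
    ... | yes a⊢⊥ = a⊢⊥
    ... | no  a⊬⊥ = ⊥-elim (a∉S (maximal (Relative S a) (relative-separator a)
                                          a⊬⊥ (weaken a) (⊢-refl a)))
      where open IsUltraseparator ultra using (maximal)

    complete⇒ultra : ExcludedMiddle ℓ → Consistent S → Complete S → IsUltraseparator S
    complete⇒ultra em consistent complete = record
      { separator = sep ; consistent = consistent ; maximal = maximal }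
      where
      maximal : ∀ R → IsSeparator R → Consistent R → S ⊆ R → R ⊆ S
      maximal R R-sep R-consistent S⊆R {t} t∈R with em {S t}
      ... | yes t∈S = t∈S
      ... | no  t∉S = ⊥-elim (R-consistent
                        (IsSeparator.mp R-sep (S⊆R (complete t t∉S)) t∈R))

    complete-⊢⇔→ : ExcludedMiddle ℓ → Complete S → ∀ a b → a ⊢[ S ] b ⇔ (S a → S b)
    complete-⊢⇔→ em complete a b = mk⇔ mp entails
      where
      entails : (S a → S b) → a ⊢[ S ] b
      entails h with em {S a}
      ... | yes a∈S = weaken a (h a∈S)
      ... | no  a∉S = ⊢-≼ (complete a a∉S) ⊥-least

    complete⇒two-valued : ExcludedMiddle ℓ → Consistent S → Complete S →
                          QuotientIsTwoElementBA S
    complete⇒two-valued em consistent complete = χ , onto , order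
      where
      χ : Carrier → Bool
      χ a = isYes (em {S a})

      χ-true⇔∈ : ∀ {a} → T (χ a) ⇔ S a
      χ-true⇔∈ = mk⇔ toWitness fromWitness

      χ-false : ∀ {a} → ¬ S a → χ a ≡ false
      χ-false {a} a∉S with em {S a}
      ... | yes a∈S = ⊥-elim (a∉S a∈S)
      ... | no  _   = refl

      onto : ∀ β → ∃ λ a → χ a ≡ β
      onto true  = 𝐊 , to T-≡ (from χ-true⇔∈ K∈S)
      onto false = ⊥ , χ-false consistent

      order : ∀ a b → a ⊢[ S ] b ⇔ (χ a B.≤ χ b)
      order a b = ⇔.trans (complete-⊢⇔→ em complete a b)
                   (⇔.trans (→-cong-⇔ (⇔.sym χ-true⇔∈) (⇔.sym χ-true⇔∈))
                            (⇔.sym ≤⇔T-implication))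

    -- Conversely, an isomorphism A/S ≅ 2 is the characteristic function of S,
    -- which makes S consistent (⊥ is bottom) and complete (a ∉ S sits below ⊥).
    two-valued⇒complete : QuotientIsTwoElementBA S → Consistent S × Complete S
    two-valued⇒complete (f , onto , order) = consistent , complete
      where
      ⊢⇔truth : ∀ {a b} → a ⊢[ S ] b ⇔ (T (f a) → T (f b))
      ⊢⇔truth {a} {b} = ⇔.trans (order a b) ≤⇔T-implication

      ∈⇒true : ∀ {x} → S x → T (f x)
      ∈⇒true {x} x∈S with onto true
      ... | a , fa≡true = to ⊢⇔truth (weaken a x∈S) (from T-≡ fa≡true)

      true⇒∈ : ∀ {x} → T (f x) → S x
      true⇒∈ tx = mp (from ⊢⇔truth (λ _ → tx)) K∈S

      consistent : Consistent S
      consistent ⊥∈S with onto false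
      ... | a , fa≡false = subst T fa≡false (to ⊢⇔truth (ex-falso a) (∈⇒true ⊥∈S))

      complete : Complete S
      complete a a∉S = from ⊢⇔truth (λ ta → ⊥-elim (a∉S (true⇒∈ ta)))

proposition3p25 : ∀ {ℓ} → ExcludedMiddle ℓ → (𝒜 : ImplicativeStructure ℓ) →
    let open ImplicativeStructure 𝒜 in
    ∀ (S : Pred Carrier) → IsSeparator S →
    IsUltraseparator S ⇔ QuotientIsTwoElementBA S
proposition3p25 em 𝒜 S sep = mk⇔ ultra⇒two two⇒ultra
  where
  open ImplicativeStructure 𝒜 using (IsUltraseparator; QuotientIsTwoElementBA)
  open SeparatorTheory 𝒜

  ultra⇒two : IsUltraseparator S → QuotientIsTwoElementBA S
  ultra⇒two ultra = complete⇒two-valued sep em (IsUltraseparator.consistent ultra)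
                                         (ultra⇒complete sep em ultra)

  two⇒ultra : QuotientIsTwoElementBA S → IsUltraseparator S
  two⇒ultra two with two-valued⇒complete sep two
  ... | consistent , complete = complete⇒ultra sep em consistent complete
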